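{- Let $x$ be a binary word of length $n$ with $x[1] = 0$, and let $\pi = \pi_x$. Then for every $1 \le i \le n$, $\pi[i] = i-1$ if and only if $x[i] = 0$.
   Context: For a binary word $w$ over $\{0,1\}$, $ones(w)$ denotes the number of $1$'s in $w$. Two binary words of equal length are abelian equivalent if they have the same number of $1$'s. An abelian border of a binary word $w$ is a proper prefix of $w$ (a prefix different from $w$, possibly empty) that is abelian equivalent to the proper suffix of $w$ of the same length. For a binary word $x$ of length $n$, the abelian border array $\pi_x$ is the array of length $n$ with $\pi_x[i]$ ($1\le i\le n$) equal to the length of the longest abelian border of the prefix $x[1\cdots i]$. (In the paper, $x$ is called the generating word of $\pi$; by convention the generating word begins with $0$.) -}

module Defs where

open import Data.Bool using (Bool; true; false)
open import Data.Nat using (ℕ; zero; suc; _∸_; _≟_)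
open import Data.List using (List; []; _∷_; length; take; drop)
open import Relation.Nullary using (yes; no)
open import Relation.Binary.PropositionalEquality using (_≡_)

-- Binary words: lists over Bool, with false = letter 0 and true = letter 1.

ones : List Bool → ℕ
ones [] = 0
ones (true ∷ w) = suc (ones w)
ones (false ∷ w) = ones w

prefix : ℕ → List Bool → List Bool
prefix k w = take k w

suffix : ℕ → List Bool → List Bool
suffix k w = drop (length w ∸ k) w

longestUpTo : List Bool → ℕ → ℕ
longestUpTo w zero = zero
longestUpTo w (suc m) with ones (prefix (suc m) w) ≟ ones (suffix (suc m) w)
... | yes _ = suc m
... | no  _ = longestUpTo w m

-- length of the longest abelian border of a nonempty word w
-- (proper: lengths 0 … |w|-1)
longestAbelianBorder : List Bool → ℕ
longestAbelianBorder w = longestUpTo w (length w ∸ 1)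

-- abelian border array, 1-indexed: π_x[i] = longest abelian border of x[1..i]
abelianBorderArray : List Bool → ℕ → ℕ
abelianBorderArray x i = longestAbelianBorder (take i x)

-- For i ≥ 2 write x[1..i] = 0uc. Since i - 1 is the longest proper length,
-- π[i] = i - 1 exactly when the prefix 0u and the suffix uc are abelian
-- equivalent. The leading 0 contributes no 1's, so this says
-- ones(u) = ones(u) + ones(c), i.e. c = 0.
{-# OPTIONS --safe #-}
module Submission where

open import Defs
open import Data.Bool using (Bool; false; true)
open import Data.Nat using (ℕ; zero; suc; _+_; _≤_; _≟_; z≤n)
open import Data.Nat.Properties
  using (≤-refl; m≤n⇒m≤1+n; 1+n≰n; +-identityʳ; +-comm; m+1+n≢m; m≤n⇒m⊓n≡m; <⇒≤; m+n∸n≡m)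
open import Data.List using (List; []; _∷_; _++_; _∷ʳ_; length; lookup; take; drop)
open import Data.List.Properties using (length-++; length-take; take-suc)
open import Data.Fin using (Fin; toℕ; zero; suc)
open import Data.Fin.Properties using (toℕ<n)
open import Data.Empty using (⊥-elim)
open import Level using (0ℓ)
open import Relation.Binary.PropositionalEquality using (_≡_; refl; sym; trans; cong; cong₂)
open import Relation.Nullary using (yes; no)
open import Function.Bundles using (_⇔_; mk⇔)
open import Function.Properties.Equivalence using (⇔-setoid)
open import Relation.Binary.Reasoning.Setoid (⇔-setoid 0ℓ)

length-∷ʳ : {A : Set} (xs : List A) (x : A) → length (xs ∷ʳ x) ≡ suc (length xs)
length-∷ʳ xs x = trans (length-++ xs) (+-comm (length xs) 1)

take-length-++ : {A : Set} (xs ys : List A) → take (length xs) (xs ++ ys) ≡ xs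
take-length-++ []       ys = refl
take-length-++ (x ∷ xs) ys = cong (x ∷_) (take-length-++ xs ys)

length-take-≤ : {A : Set} (n : ℕ) (xs : List A) → n ≤ length xs → length (take n xs) ≡ n
length-take-≤ n xs n≤∣xs∣ = trans (length-take n xs) (m≤n⇒m⊓n≡m n≤∣xs∣)

longestUpTo-≤ : (w : List Bool) (m : ℕ) → longestUpTo w m ≤ m
longestUpTo-≤ w zero = z≤n
longestUpTo-≤ w (suc m) with ones (prefix (suc m) w) ≟ ones (suffix (suc m) w)
... | yes _ = ≤-refl
... | no  _ = m≤n⇒m≤1+n (longestUpTo-≤ w m)

longestUpTo-suc≡suc⇔ : (w : List Bool) (m : ℕ) →
  (longestUpTo w (suc m) ≡ suc m) ⇔ (ones (prefix (suc m) w) ≡ ones (suffix (suc m) w))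
longestUpTo-suc≡suc⇔ w m with ones (prefix (suc m) w) ≟ ones (suffix (suc m) w)
... | yes p = mk⇔ (λ _ → p) (λ _ → refl)
... | no ¬p = mk⇔ (λ eq → ⊥-elim (1+n≰n (1+m≤m eq))) (λ p → ⊥-elim (¬p p))
  where
  1+m≤m : longestUpTo w m ≡ suc m → suc m ≤ m
  1+m≤m eq rewrite sym eq = longestUpTo-≤ w m

ones-++ : (xs ys : List Bool) → ones (xs ++ ys) ≡ ones xs + ones ys
ones-++ []           ys = refl
ones-++ (true  ∷ xs) ys = cong suc (ones-++ xs ys)
ones-++ (false ∷ xs) ys = ones-++ xs ys

n≡n+ones[b]⇔b≡false : (n : ℕ) (b : Bool) → (n ≡ n + ones (b ∷ [])) ⇔ (b ≡ false)
n≡n+ones[b]⇔b≡false n false = mk⇔ (λ _ → refl) (λ _ → sym (+-identityʳ n))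
n≡n+ones[b]⇔b≡false n true  = mk⇔ (λ eq → ⊥-elim (m+1+n≢m n (sym eq))) (λ ())

suffix-length-∷ : (x : Bool) (xs : List Bool) → suffix (length xs) (x ∷ xs) ≡ xs
suffix-length-∷ x xs = cong (λ k → drop k (x ∷ xs)) (m+n∸n≡m 1 (length xs))

longestAbelianBorder[0∷u∷ʳc]≡1+∣u∣⇔c≡false : (u : List Bool) (c : Bool) →
  (longestAbelianBorder (false ∷ u ∷ʳ c) ≡ suc (length u)) ⇔ (c ≡ false)
longestAbelianBorder[0∷u∷ʳc]≡1+∣u∣⇔c≡false u c = begin
  longestUpTo w (length (u ∷ʳ c)) ≡ suc (length u)
    ≡⟨ cong (λ m → longestUpTo w m ≡ suc (length u)) (length-∷ʳ u c) ⟩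
  longestUpTo w (suc (length u)) ≡ suc (length u)
    ≈⟨ longestUpTo-suc≡suc⇔ w (length u) ⟩
  ones (prefix (suc (length u)) w) ≡ ones (suffix (suc (length u)) w)
    ≡⟨ cong₂ (λ p s → ones p ≡ ones s) (take-length-++ u (c ∷ [])) suffix≡u∷ʳc ⟩
  ones u ≡ ones (u ∷ʳ c)
    ≡⟨ cong (ones u ≡_) (ones-++ u (c ∷ [])) ⟩
  ones u ≡ ones u + ones (c ∷ [])
    ≈⟨ n≡n+ones[b]⇔b≡false (ones u) c ⟩
  c ≡ false ∎
  where
  w : List Bool
  w = false ∷ u ∷ʳ c

  suffix≡u∷ʳc : suffix (suc (length u)) w ≡ u ∷ʳ c
  suffix≡u∷ʳc = trans (cong (λ k → suffix k w) (sym (length-∷ʳ u c)))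
                      (suffix-length-∷ false (u ∷ʳ c))

mainTheorem6 : (y : List Bool) (j : Fin (length (false ∷ y))) →
    (abelianBorderArray (false ∷ y) (suc (toℕ j)) ≡ toℕ j) ⇔ (lookup (false ∷ y) j ≡ false)
mainTheorem6 y zero    = mk⇔ (λ _ → refl) (λ _ → refl)
mainTheorem6 y (suc j) = begin
  longestAbelianBorder (false ∷ take (suc (toℕ j)) y) ≡ suc (toℕ j)
    ≡⟨ cong₂ (λ v n → longestAbelianBorder (false ∷ v) ≡ suc n)
             (take-suc y j) (sym (length-take-≤ (toℕ j) y (<⇒≤ (toℕ<n j)))) ⟩
  longestAbelianBorder (false ∷ u ∷ʳ lookup y j) ≡ suc (length u)
    ≈⟨ longestAbelianBorder[0∷u∷ʳc]≡1+∣u∣⇔c≡false u (lookup y j) ⟩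
  lookup y j ≡ false ∎
  where
  u : List Bool
  u = take (toℕ j) y
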